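{- Let $\mathcal{D}=(X,\mathcal{B})$ be a quasi-symmetric $2$-$(56,12,9)$ design with block intersection numbers $0$ and $3$, and let $z\in X$. (i) The derived design $\mathcal{D}^z$ is a $1$-$(55,11,9)$ design with $45$ blocks, and its dual design $(\mathcal{D}^z)^*$ is a $2$-$(45,9,2)$ design. (ii) The residual design $\mathcal{D}_z$ is a $1$-$(55,12,36)$ design with $165$ blocks, and every column of the $55\times 165$ (points by blocks) incidence matrix of $\mathcal{D}_z$ belongs to the dual code $C^\perp$ of the linear code $C$ over $GF(3)$ spanned by the columns of the $55\times 45$ (points by blocks) incidence matrix of $\mathcal{D}^z$.
   Context: A $t$-$(v,k,\lambda)$ design is a set of $v$ points with a collection of $k$-subsets (blocks) such that every $t$-subset of points lies in exactly $\lambda$ blocks. A $2$-design is quasi-symmetric with intersection numbers $x<y$ if every two distinct blocks meet in $x$ or $y$ points. For a point $z$ of a design $(X,\mathcal{B})$, the derived design $\mathcal{D}^z$ has point set $X\setminus\{z\}$ and blocks $B\setminus\{z\}$ for $B\in\mathcal{B}$ with $z\in B$; the residual design $\mathcal{D}_z$ has point set $X\setminus\{z\}$ and blocks $B\in\mathcal{B}$ with $z\notin B$. The dual design of a design has as points the blocks and as blocks the points of the original design, with incidence preserved (incidence matrix transposed). The incidence matrix has rows indexed by points and columns by blocks, with entry $1$ iff the point lies in the block. The dual code $C^\perp$ is taken with respect to the standard inner product over $GF(3)$. -}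

module Defs where

open import Data.Nat using (ℕ; zero; suc; _+_; _*_)
open import Data.Nat.DivMod using (_mod_)
open import Data.Bool using (Bool; true; false; _∧_; _∨_; not; if_then_else_)
open import Data.Fin using (Fin; zero; suc; toℕ; punchIn)
open import Data.Fin.Subset using (Subset; ∣_∣; _∈_)
open import Data.Vec using (lookup)
open import Data.Product using (_×_; ∃)
open import Data.Sum using (_⊎_)
open import Relation.Binary.PropositionalEquality using (_≡_; _≢_)
open import Function.Definitions using (Injective)

-- Incidence structures: v points (Fin v), b blocks (Fin b),
-- incidence matrix M p j = true iff point p lies in block j (points × blocks).
Incidence : ℕ → ℕ → Set
Incidence v b = Fin v → Fin b → Bool

count : {n : ℕ} → (Fin n → Bool) → ℕ
count {zero}  f = 0
count {suc n} f = (if f zero then 1 else 0) + count (λ i → f (suc i))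

allF : {n : ℕ} → (Fin n → Bool) → Bool
allF {zero}  f = true
allF {suc n} f = f zero ∧ allF (λ i → f (suc i))

contains : {v b : ℕ} → Incidence v b → Subset v → Fin b → Bool
contains M S j = allF (λ p → not (lookup S p) ∨ M p j)

dual : {v b : ℕ} → Incidence v b → Incidence b v
dual M j p = M p j

IsDesign : (t v k lam b : ℕ) → Incidence v b → Set
IsDesign t v k lam b M =
  ((j : Fin b) → count (λ p → M p j) ≡ k) ×
  ((S : Subset v) → ∣ S ∣ ≡ t → count (contains M S) ≡ lam)

IsQuasiSymmetric2 : (v k lam x y b : ℕ) → Incidence v b → Set
IsQuasiSymmetric2 v k lam x y b M =
  IsDesign 2 v k lam b M ×
  ((i j : Fin b) → i ≢ j →
     (count (λ p → M p i ∧ M p j) ≡ x) ⊎ (count (λ p → M p i ∧ M p j) ≡ y))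

Enumerates : {b n : ℕ} → (Fin b → Bool) → (Fin n → Fin b) → Set
Enumerates {b} {n} P e =
  Injective _≡_ _≡_ e ×
  ((j : Fin n) → P (e j) ≡ true) ×
  ((i : Fin b) → P i ≡ true → ∃ λ j → e j ≡ i)

-- Derived / residual incidence matrices at point z (point set X ∖ {z},
-- indexed by Fin v via punchIn z), for given block enumerations.
derivedM : {v b n : ℕ} → Incidence (suc v) b → Fin (suc v) → (Fin n → Fin b) → Incidence v n
derivedM M z e p j = M (punchIn z p) (e j)

residualM : {v b n : ℕ} → Incidence (suc v) b → Fin (suc v) → (Fin n → Fin b) → Incidence v n
residualM M z e p j = M (punchIn z p) (e j)

GF3 : Set
GF3 = Fin 3

_+₃_ : GF3 → GF3 → GF3
a +₃ c = (toℕ a + toℕ c) mod 3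

_*₃_ : GF3 → GF3 → GF3
a *₃ c = (toℕ a * toℕ c) mod 3

sum₃ : {n : ℕ} → (Fin n → GF3) → GF3
sum₃ {zero}  f = zero
sum₃ {suc n} f = f zero +₃ sum₃ (λ i → f (suc i))

toGF3 : Bool → GF3
toGF3 true  = suc zero
toGF3 false = zero

column : {v b : ℕ} → Incidence v b → Fin b → (Fin v → GF3)
column M j p = toGF3 (M p j)

dot : {v : ℕ} → (Fin v → GF3) → (Fin v → GF3) → GF3
dot x y = sum₃ (λ p → x p *₃ y p)

InCode : {v b : ℕ} → Incidence v b → (Fin v → GF3) → Set
InCode {v} {b} M x = ∃ λ (a : Fin b → GF3) →
  (p : Fin v) → x p ≡ sum₃ (λ j → a j *₃ column M j p)

InDualCode : {v b : ℕ} → Incidence v b → (Fin v → GF3) → Set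
InDualCode {v} M y = (x : Fin v → GF3) → InCode M x → dot x y ≡ zero

-- Double counting in the 2-(56,12,9) design gives replication number r = 9·55/11 = 45 and
-- b = 56·45/12 = 210 blocks. The blocks through z form the derived design; two of them
-- share z, so they meet in 3 points, i.e. in 2 points after z is deleted, which makes the
-- dual of the derived design a 2-design. A block through z and a block missing z meet in
-- 0 or 3 points, both divisible by 3, so the corresponding columns are orthogonal over GF(3).
module Submission where

open import Defs
open import Relation.Binary.PropositionalEquality
  using (_≡_; _≢_; _≗_; refl; sym; trans; cong; cong₂; subst; isEquivalence; module ≡-Reasoning)
open import Level using (0ℓ)
open import Algebra.Bundles using (CommutativeSemiring)
open import Algebra.Definitions (_≡_ {A = GF3})
  using (Associative; Commutative; LeftIdentity; _DistributesOverʳ_; LeftZero)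
open import Algebra.Structures.Biased (_≡_ {A = GF3})
  using (isCommutativeMonoidˡ; isCommutativeSemiringˡ)
import Algebra.Properties.Semiring.Sum as SemiringSum
open import Data.Nat using (ℕ; zero; suc; _+_; _*_; _%_)
open import Data.Nat.Properties
  using (+-*-semiring; *-suc; *-identityˡ; +-identityʳ; +-cancelˡ-≡; *-cancelʳ-≡;
         1+n≢0; 0≢1+n; suc-injective)
open import Data.Nat.DivMod using (_mod_; m%n<n; %-distribˡ-+)
open import Data.Bool using (Bool; true; false; not; _∧_; _∨_; if_then_else_) renaming (_≟_ to _≟ᵇ_)
open import Data.Bool.Properties
  using (not-injective; ∧-idem; ∧-identityʳ; ∧-zeroʳ; ∧-conicalˡ; ∧-conicalʳ; ¬-not; ⇔→≡)
open import Data.Fin using (Fin; zero; suc; toℕ; punchIn; punchOut; _≟_)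
open import Data.Fin.Properties
  using (all?; any?; toℕ-injective; toℕ-fromℕ<; punchInᵢ≢i; punchIn-punchOut; punchIn-injective)
open import Data.Fin.Subset using (Subset; ∣_∣; ⁅_⁆; _∪_)
open import Data.Fin.Subset.Properties using (x∈⁅x⁆; x∈⁅y⁆⇒x≡y; x∈p∪q⁺; x∈p∪q⁻)
open import Data.Vec using ([]; _∷_; lookup)
open import Data.Vec.Properties using ([]=⇒lookup; lookup⇒[]=)
open import Data.Product using (_×_; _,_; ∃; ∃₂; proj₁)
open import Data.Sum using (_⊎_; inj₁; inj₂; [_,_]′; reduce; map)
open import Function using (_∘_; mk⇔)
open import Relation.Nullary using (does; yes; no; contradiction)
open import Relation.Nullary.Decidable using (toWitness; dec-true; dec-false)
open ≡-Reasoning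

module ℕΣ = SemiringSum +-*-semiring
open ℕΣ using (sum; sum-syntax; ∑-comm; ∑-distrib-+; sum-remove; sum-cong-≗; *-distribʳ-sum)

-- Counting

indicator : Bool → ℕ
indicator b = if b then 1 else 0

count≡sum : ∀ {n} (f : Fin n → Bool) → count f ≡ ∑[ i < n ] indicator (f i)
count≡sum {zero}  f = refl
count≡sum {suc n} f = cong (indicator (f zero) +_) (count≡sum (f ∘ suc))

sum-const : ∀ {n c} {f : Fin n → ℕ} → (∀ i → f i ≡ c) → ∑[ i < n ] f i ≡ n * c
sum-const {zero}  f≡c = refl
sum-const {suc n} f≡c = cong₂ _+_ (f≡c zero) (sum-const (f≡c ∘ suc))

count-cong : ∀ {n} {f g : Fin n → Bool} → f ≗ g → count f ≡ count g
count-cong {zero}  f≗g = refl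
count-cong {suc n} f≗g = cong₂ _+_ (cong indicator (f≗g zero)) (count-cong (f≗g ∘ suc))

count-false : ∀ {n} {f : Fin n → Bool} → (∀ i → f i ≡ false) → count f ≡ 0
count-false {zero}  f≡false = refl
count-false {suc n} f≡false rewrite f≡false zero = count-false (f≡false ∘ suc)

count-true : ∀ n → count {n} (λ _ → true) ≡ n
count-true zero    = refl
count-true (suc n) = cong suc (count-true n)

count-remove : ∀ {n} (f : Fin (suc n) → Bool) x → count f ≡ indicator (f x) + count (f ∘ punchIn x)
count-remove f x = begin
  count f                                            ≡⟨ count≡sum f ⟩
  sum (indicator ∘ f)                                ≡⟨ sum-remove {i = x} (indicator ∘ f) ⟩
  indicator (f x) + sum (indicator ∘ f ∘ punchIn x)  ≡⟨ cong (indicator (f x) +_) (count≡sum (f ∘ punchIn x)) ⟨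
  indicator (f x) + count (f ∘ punchIn x)            ∎

count-remove-true : ∀ {n} (f : Fin (suc n) → Bool) {x} → f x ≡ true →
  count f ≡ suc (count (f ∘ punchIn x))
count-remove-true f {x} fx = trans (count-remove f x) (cong (λ c → indicator c + count (f ∘ punchIn x)) fx)

count-remove-false : ∀ {n} (f : Fin (suc n) → Bool) {x} → f x ≡ false →
  count f ≡ count (f ∘ punchIn x)
count-remove-false f {x} fx = trans (count-remove f x) (cong (λ c → indicator c + count (f ∘ punchIn x)) fx)

count-∧ˡ : ∀ {n} c (f : Fin n → Bool) → count (λ i → c ∧ f i) ≡ indicator c * count f
count-∧ˡ true  f = sym (*-identityˡ (count f))
count-∧ˡ false f = count-false {f = λ i → false ∧ f i} (λ _ → refl)

count-split : ∀ {n} (f g : Fin n → Bool) →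
  count g ≡ count (λ i → f i ∧ g i) + count (λ i → not (f i) ∧ g i)
count-split {n} f g = begin
  count g                      ≡⟨ count≡sum g ⟩
  ∑[ i < n ] indicator (g i)   ≡⟨ sum-cong-≗ (λ i → split (f i) (g i)) ⟩
  ∑[ i < n ] (indicator (f i ∧ g i) + indicator (not (f i) ∧ g i))
    ≡⟨ ∑-distrib-+ (λ i → indicator (f i ∧ g i)) (λ i → indicator (not (f i) ∧ g i)) ⟩
  sum (λ i → indicator (f i ∧ g i)) + sum (λ i → indicator (not (f i) ∧ g i))
    ≡⟨ cong₂ _+_ (count≡sum (λ i → f i ∧ g i)) (count≡sum (λ i → not (f i) ∧ g i)) ⟨
  count (λ i → f i ∧ g i) + count (λ i → not (f i) ∧ g i)   ∎
  where
  split : ∀ a c → indicator c ≡ indicator (a ∧ c) + indicator (not a ∧ c)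
  split true  c = sym (+-identityʳ (indicator c))
  split false c = refl

∑-count-comm : ∀ {m n} (R : Fin m → Fin n → Bool) →
  ∑[ i < m ] count (R i) ≡ ∑[ j < n ] count (λ i → R i j)
∑-count-comm {m} {n} R = begin
  ∑[ i < m ] count (R i)                   ≡⟨ sum-cong-≗ (λ i → count≡sum (R i)) ⟩
  ∑[ i < m ] ∑[ j < n ] indicator (R i j)  ≡⟨ ∑-comm (λ i j → indicator (R i j)) ⟩
  ∑[ j < n ] ∑[ i < m ] indicator (R i j)  ≡⟨ sum-cong-≗ (λ j → count≡sum (λ i → R i j)) ⟨
  ∑[ j < n ] count (λ i → R i j)           ∎

Selects : ∀ {n} → (Fin n → Bool) → Fin n → Fin n → Set
Selects f x y = f x ≡ true × f y ≡ true × (∀ w → f w ≡ true → w ≡ x ⊎ w ≡ y)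

punchIn-or-pivot : ∀ {n} (x w : Fin (suc n)) → w ≡ x ⊎ ∃ λ i → punchIn x i ≡ w
punchIn-or-pivot x w with x ≟ w
... | yes x≡w = inj₁ (sym x≡w)
... | no x≢w  = inj₂ (punchOut x≢w , punchIn-punchOut x≢w)

count≡0⇒false : ∀ {n} (f : Fin n → Bool) → count f ≡ 0 → ∀ x → f x ≡ false
count≡0⇒false {suc n} f c x with f x in fx
... | false = refl
... | true  = contradiction (trans (sym (count-remove-true f fx)) c) 1+n≢0

count-suc⇒true : ∀ {n k} (f : Fin (suc n) → Bool) → count f ≡ suc k →
  ∃ λ x → f x ≡ true × count (f ∘ punchIn x) ≡ k
count-suc⇒true f c with any? (λ x → f x ≟ᵇ true)
... | yes (x , fx) = x , fx , suc-injective (trans (sym (count-remove-true f fx)) c)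
... | no ¬true     =
  contradiction (trans (sym (count-false λ x → ¬-not (λ fx → ¬true (x , fx)))) c) 0≢1+n

count≡1⇒selects : ∀ {n} (f : Fin n → Bool) → count f ≡ 1 → ∃ λ x → Selects f x x
count≡1⇒selects {zero}  f ()
count≡1⇒selects {suc n} f c with count-suc⇒true f c
... | x , fx , rest = x , fx , fx , only-x
  where
  only-x : ∀ w → f w ≡ true → w ≡ x ⊎ w ≡ x
  only-x w fw with punchIn-or-pivot x w
  ... | inj₁ w≡x     = inj₁ w≡x
  ... | inj₂ (i , refl) = contradiction (trans (sym fw) (count≡0⇒false (f ∘ punchIn x) rest i)) λ ()

count≡2⇒selects : ∀ {n} (f : Fin n → Bool) → count f ≡ 2 → ∃₂ λ x y → x ≢ y × Selects f x y
count≡2⇒selects {zero}  f ()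
count≡2⇒selects {suc n} f c with count-suc⇒true f c
... | x , fx , rest with count≡1⇒selects (f ∘ punchIn x) rest
...   | i , fi , _ , only-i = x , punchIn x i , punchInᵢ≢i x i ∘ sym , fx , fi , only-x-y
  where
  only-x-y : ∀ w → f w ≡ true → w ≡ x ⊎ w ≡ punchIn x i
  only-x-y w fw with punchIn-or-pivot x w
  ... | inj₁ w≡x        = inj₁ w≡x
  ... | inj₂ (j , refl) = inj₂ (cong (punchIn x) (reduce (only-i j fw)))

selects⇒count≡1 : ∀ {n} {f : Fin n → Bool} {x} → Selects f x x → count f ≡ 1
selects⇒count≡1 {suc n} {f} {x} (fx , _ , only-x) =
  trans (count-remove-true f fx)
        (cong suc (count-false λ i → ¬-not (punchInᵢ≢i x i ∘ reduce ∘ only-x (punchIn x i))))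

selects⇒count≡2 : ∀ {n} {f : Fin n → Bool} {x y} → x ≢ y → Selects f x y → count f ≡ 2
selects⇒count≡2 {suc n} {f} {x} {y} x≢y (fx , fy , only-x-y) =
  trans (count-remove-true f fx) (cong suc (selects⇒count≡1 (fi , fi , only-i)))
  where
  i : Fin n
  i = punchOut x≢y
  fi : f (punchIn x i) ≡ true
  fi = trans (cong f (punchIn-punchOut x≢y)) fy
  only-i : ∀ j → f (punchIn x j) ≡ true → j ≡ i ⊎ j ≡ i
  only-i j fj with only-x-y (punchIn x j) fj
  ... | inj₁ ≡x = contradiction ≡x (punchInᵢ≢i x j)
  ... | inj₂ ≡y = inj₁ (punchIn-injective x j i (trans ≡y (sym (punchIn-punchOut x≢y))))

∣S∣≡count : ∀ {n} (S : Subset n) → ∣ S ∣ ≡ count (lookup S)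
∣S∣≡count []          = refl
∣S∣≡count (true ∷ S)  = cong suc (∣S∣≡count S)
∣S∣≡count (false ∷ S) = ∣S∣≡count S

pair-selects : ∀ {n} (x y : Fin n) → Selects (lookup (⁅ x ⁆ ∪ ⁅ y ⁆)) x y
pair-selects x y =
  []=⇒lookup (x∈p∪q⁺ {q = ⁅ y ⁆} (inj₁ (x∈⁅x⁆ x))) ,
  []=⇒lookup (x∈p∪q⁺ {p = ⁅ x ⁆} (inj₂ (x∈⁅x⁆ y))) ,
  λ w w∈ → map (x∈⁅y⁆⇒x≡y x) (x∈⁅y⁆⇒x≡y y) (x∈p∪q⁻ ⁅ x ⁆ ⁅ y ⁆ (lookup⇒[]= w _ w∈))

allF-elim : ∀ {n} {f : Fin n → Bool} → allF f ≡ true → ∀ x → f x ≡ true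
allF-elim {f = f} all zero    = ∧-conicalˡ (f zero) _ all
allF-elim {f = f} all (suc x) = allF-elim (∧-conicalʳ (f zero) _ all) x

allF-intro : ∀ {n} {f : Fin n → Bool} → (∀ x → f x ≡ true) → allF f ≡ true
allF-intro {zero}  f≡true = refl
allF-intro {suc n} f≡true rewrite f≡true zero = allF-intro (f≡true ∘ suc)

contains-selects : ∀ {v b} (M : Incidence v b) (S : Subset v) {x y} → Selects (lookup S) x y →
  ∀ j → contains M S j ≡ M x j ∧ M y j
contains-selects M S {x} {y} (x∈ , y∈ , only-x-y) j = ⇔→≡ (mk⇔ to from)
  where
  to : contains M S j ≡ true → M x j ∧ M y j ≡ true
  to all = cong₂ _∧_ (member x∈) (member y∈)
    where
    member : ∀ {w} → lookup S w ≡ true → M w j ≡ true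
    member {w} w∈ = subst (λ s → not s ∨ M w j ≡ true) w∈ (allF-elim all w)
  from : M x j ∧ M y j ≡ true → contains M S j ≡ true
  from both = allF-intro member
    where
    member : ∀ w → not (lookup S w) ∨ M w j ≡ true
    member w with lookup S w in w∈
    ... | false = refl
    ... | true with only-x-y w w∈
    ...   | inj₁ refl = ∧-conicalˡ _ _ both
    ...   | inj₂ refl = ∧-conicalʳ _ _ both

-- Designs

degree : ∀ {v b} → Incidence v b → Fin v → ℕ
degree M x = count (M x)

common : ∀ {v b} → Incidence v b → Fin v → Fin v → ℕ
common M x y = count (λ j → M x j ∧ M y j)

isDesign₁ : ∀ {v k r b} {M : Incidence v b} →
  (∀ j → degree (dual M) j ≡ k) → (∀ x → degree M x ≡ r) → IsDesign 1 v k r b M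
isDesign₁ {M = M} blocks points = blocks , λ S ∣S∣≡1 →
  let x , sel = count≡1⇒selects (lookup S) (trans (sym (∣S∣≡count S)) ∣S∣≡1)
  in trans (count-cong {f = contains M S} λ j → trans (contains-selects M S sel j) (∧-idem (M x j)))
           (points x)

isDesign₂ : ∀ {v k lam b} {M : Incidence v b} →
  (∀ j → degree (dual M) j ≡ k) → (∀ x y → x ≢ y → common M x y ≡ lam) → IsDesign 2 v k lam b M
isDesign₂ {M = M} blocks pairs = blocks , λ S ∣S∣≡2 →
  let x , y , x≢y , sel = count≡2⇒selects (lookup S) (trans (sym (∣S∣≡count S)) ∣S∣≡2)
  in trans (count-cong {f = contains M S} (contains-selects M S sel)) (pairs x y x≢y)

IsDesign₂-common : ∀ {v k lam b} {M : Incidence v b} → IsDesign 2 v k lam b M →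
  ∀ {x y} → x ≢ y → common M x y ≡ lam
IsDesign₂-common {M = M} (_ , pairs) {x} {y} x≢y =
  trans (count-cong {g = contains M (⁅ x ⁆ ∪ ⁅ y ⁆)} λ j → sym (contains-selects M (⁅ x ⁆ ∪ ⁅ y ⁆) sel j))
        (pairs (⁅ x ⁆ ∪ ⁅ y ⁆) ∣pair∣≡2)
  where
  sel : Selects (lookup (⁅ x ⁆ ∪ ⁅ y ⁆)) x y
  sel = pair-selects x y
  ∣pair∣≡2 : ∣ ⁅ x ⁆ ∪ ⁅ y ⁆ ∣ ≡ 2
  ∣pair∣≡2 = trans (∣S∣≡count (⁅ x ⁆ ∪ ⁅ y ⁆)) (selects⇒count≡2 x≢y sel)

incidences : ∀ {v b k r} {M : Incidence v b} →
  (∀ j → degree (dual M) j ≡ k) → (∀ x → degree M x ≡ r) → b * k ≡ v * r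
incidences {v} {b} {k} {r} {M} blocks points = begin
  b * k                           ≡⟨ sum-const blocks ⟨
  ∑[ j < b ] degree (dual M) j    ≡⟨ ∑-count-comm M ⟨
  ∑[ x < v ] degree M x           ≡⟨ sum-const points ⟩
  v * r                           ∎

replication : ∀ {v k lam b} {M : Incidence (suc v) b} → IsDesign 2 (suc v) (suc k) lam b M →
  ∀ x → degree M x * k ≡ v * lam
replication {v} {k} {lam} {b} {M} design@(blocks , _) x = +-cancelˡ-≡ r _ _ (begin
  r + r * k                                        ≡⟨ *-suc r k ⟨
  r * suc k                                        ≡⟨ cong (_* suc k) (count≡sum (M x)) ⟩
  sum (indicator ∘ M x) * suc k                    ≡⟨ *-distribʳ-sum (suc k) (indicator ∘ M x) ⟩
  ∑[ j < b ] (indicator (M x j) * suc k)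
    ≡⟨ sum-cong-≗ (λ j → trans (count-∧ˡ (M x j) (dual M j)) (cong (indicator (M x j) *_) (blocks j))) ⟨
  ∑[ j < b ] count (λ y → M x j ∧ M y j)
    ≡⟨ ∑-count-comm (λ y j → M x j ∧ M y j) ⟨
  ∑[ y < suc v ] common M x y                      ≡⟨ sum-remove {i = x} (common M x) ⟩
  common M x x + ∑[ i < v ] common M x (punchIn x i)
    ≡⟨ cong₂ _+_ (count-cong {g = M x} λ j → ∧-idem (M x j))
                 (sum-const λ i → IsDesign₂-common {M = M} design (punchInᵢ≢i x i ∘ sym)) ⟩
  r + v * lam                                      ∎)
  where
  r : ℕ
  r = degree M x

≟-true⇒≡ : ∀ {n} {x y : Fin n} → does (x ≟ y) ≡ true → x ≡ y
≟-true⇒≡ {x = x} {y} h with x ≟ y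
... | yes x≡y = x≡y

fiber-size : ∀ {b n} {P : Fin b → Bool} {e : Fin n → Fin b} → Enumerates P e →
  ∀ i → count (λ j → does (e j ≟ i)) ≡ indicator (P i)
fiber-size {P = P} {e} (e-injective , e∈P , onto) i with P i in Pi
... | true  = let j , ej≡i = onto i Pi in
  selects⇒count≡1 (dec-true (e j ≟ i) ej≡i , dec-true (e j ≟ i) ej≡i ,
                   λ j′ h → inj₁ (e-injective (trans (≟-true⇒≡ h) (sym ej≡i))))
... | false = count-false λ j → dec-false (e j ≟ i) λ ej≡i →
  contradiction (trans (sym (e∈P j)) (trans (cong P ej≡i) Pi)) λ ()

count-at : ∀ {n} (g : Fin n → Bool) x → count (λ i → g i ∧ does (x ≟ i)) ≡ indicator (g x)
count-at {suc n} g x = begin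
  count (λ i → g i ∧ does (x ≟ i))
    ≡⟨ count-remove (λ i → g i ∧ does (x ≟ i)) x ⟩
  indicator (g x ∧ does (x ≟ x)) + count (λ i → g (punchIn x i) ∧ does (x ≟ punchIn x i))
    ≡⟨ cong₂ _+_ (cong (λ s → indicator (g x ∧ s)) (dec-true (x ≟ x) refl))
                 (count-cong λ i → cong (g (punchIn x i) ∧_) (dec-false (x ≟ punchIn x i) (x≢punchIn i))) ⟩
  indicator (g x ∧ true) + count (λ i → g (punchIn x i) ∧ false)
    ≡⟨ cong₂ _+_ (cong indicator (∧-identityʳ (g x)))
                 (count-false {f = λ i → g (punchIn x i) ∧ false} (∧-zeroʳ ∘ g ∘ punchIn x)) ⟩
  indicator (g x) + 0
    ≡⟨ +-identityʳ _ ⟩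
  indicator (g x)
    ∎
  where
  x≢punchIn : ∀ i → x ≢ punchIn x i
  x≢punchIn i = punchInᵢ≢i x i ∘ sym

indicator-∧ : ∀ a c → indicator c * indicator a ≡ indicator (a ∧ c)
indicator-∧ true  true  = refl
indicator-∧ true  false = refl
indicator-∧ false true  = refl
indicator-∧ false false = refl

count-enumerates : ∀ {b n} {P : Fin b → Bool} {e : Fin n → Fin b} → Enumerates P e →
  ∀ g → count (g ∘ e) ≡ count (λ i → P i ∧ g i)
count-enumerates {b} {n} {P} {e} enum g = begin
  count (g ∘ e)                                 ≡⟨ count≡sum (g ∘ e) ⟩
  ∑[ j < n ] indicator (g (e j))                ≡⟨ sum-cong-≗ (count-at g ∘ e) ⟨
  ∑[ j < n ] count (λ i → g i ∧ does (e j ≟ i)) ≡⟨ ∑-count-comm (λ j i → g i ∧ does (e j ≟ i)) ⟩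
  ∑[ i < b ] count (λ j → g i ∧ does (e j ≟ i)) ≡⟨ sum-cong-≗ fiber ⟩
  ∑[ i < b ] indicator (P i ∧ g i)              ≡⟨ count≡sum (λ i → P i ∧ g i) ⟨
  count (λ i → P i ∧ g i)                       ∎
  where
  fiber : ∀ i → count (λ j → g i ∧ does (e j ≟ i)) ≡ indicator (P i ∧ g i)
  fiber i = begin
    count (λ j → g i ∧ does (e j ≟ i))              ≡⟨ count-∧ˡ (g i) (λ j → does (e j ≟ i)) ⟩
    indicator (g i) * count (λ j → does (e j ≟ i))  ≡⟨ cong (indicator (g i) *_) (fiber-size enum i) ⟩
    indicator (g i) * indicator (P i)               ≡⟨ indicator-∧ (P i) (g i) ⟩
    indicator (P i ∧ g i)                           ∎

enumerates-size : ∀ {b n} {P : Fin b → Bool} {e : Fin n → Fin b} → Enumerates P e → n ≡ count P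
enumerates-size {n = n} {P} enum = begin
  n                            ≡⟨ count-true n ⟨
  count {n} (λ _ → true)       ≡⟨ count-enumerates enum (λ _ → true) ⟩
  count (λ i → P i ∧ true)     ≡⟨ count-cong (∧-identityʳ ∘ P) ⟩
  count P                      ∎

count-complement : ∀ {n} (f : Fin n → Bool) → count f + count (not ∘ f) ≡ n
count-complement {n} f = begin
  count f + count (not ∘ f)
    ≡⟨ cong₂ _+_ (count-cong (sym ∘ ∧-identityʳ ∘ f)) (count-cong (sym ∘ ∧-identityʳ ∘ not ∘ f)) ⟩
  count (λ i → f i ∧ true) + count (λ i → not (f i) ∧ true)
    ≡⟨ count-split f (λ _ → true) ⟨
  count {n} (λ _ → true)
    ≡⟨ count-true n ⟩
  n ∎

-- Derived and residual designs

derived-design : ∀ {v k lam y b r n} {M : Incidence (suc v) b} →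
  IsQuasiSymmetric2 (suc v) (suc k) lam 0 (suc y) b M → (∀ x → degree M x ≡ r) →
  ∀ z {e : Fin n → Fin b} → Enumerates (M z) e →
  (n ≡ r) × IsDesign 1 v k lam n (derivedM M z e) × IsDesign 2 n lam y v (dual (derivedM M z e))
derived-design {k = k} {lam} {y} {M = M} (design@(blocks , _) , meet) points z {e}
               enum@(e-injective , through-z , _) =
  trans (enumerates-size enum) (points z) , isDesign₁ blockSize pointDegree , isDesign₂ pointDegree blocksMeet
  where
  D : Incidence _ _
  D = derivedM M z e
  blockSize : ∀ j → degree (dual D) j ≡ k
  blockSize j = suc-injective (trans (sym (count-remove-true (dual M (e j)) (through-z j))) (blocks (e j)))
  pointDegree : ∀ x → degree D x ≡ lam
  pointDegree x =
    trans (count-enumerates enum (M (punchIn z x))) (IsDesign₂-common {M = M} design (punchInᵢ≢i z x ∘ sym))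
  meet-deleted : ∀ i j → common (dual M) (e i) (e j) ≡ suc (common (dual D) i j)
  meet-deleted i j =
    count-remove-true (λ p → M p (e i) ∧ M p (e j)) (cong₂ _∧_ (through-z i) (through-z j))
  blocksMeet : ∀ i j → i ≢ j → common (dual D) i j ≡ y
  blocksMeet i j i≢j with meet (e i) (e j) (i≢j ∘ e-injective)
  ... | inj₁ meet≡0   = contradiction (trans (sym (meet-deleted i j)) meet≡0) 1+n≢0
  ... | inj₂ meet≡y+1 = suc-injective (trans (sym (meet-deleted i j)) meet≡y+1)

residual-design : ∀ {v k lam b r m ρ} {M : Incidence (suc v) b} →
  IsDesign 2 (suc v) k lam b M → (∀ x → degree M x ≡ r) → lam + ρ ≡ r →
  ∀ z {o : Fin m → Fin b} → Enumerates (not ∘ M z) o →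
  (r + m ≡ b) × IsDesign 1 v k ρ m (residualM M z o)
residual-design {k = k} {lam} {b} {r} {m} {ρ} {M} design@(blocks , _) points lam+ρ≡r z {o}
                enum@(_ , outside , _) =
  r+m≡b , isDesign₁ blockSize pointDegree
  where
  R : Incidence _ m
  R = residualM M z o
  r+m≡b : r + m ≡ b
  r+m≡b = begin
    r + m                            ≡⟨ cong₂ _+_ (points z) (sym (enumerates-size enum)) ⟨
    count (M z) + count (not ∘ M z)  ≡⟨ count-complement (M z) ⟩
    b                                ∎
  blockSize : ∀ j → degree (dual R) j ≡ k
  blockSize j = trans (sym (count-remove-false (dual M (o j)) (not-injective (outside j)))) (blocks (o j))
  pointDegree : ∀ x → degree R x ≡ ρ
  pointDegree x = +-cancelˡ-≡ lam _ _ (begin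
    lam + degree R x
      ≡⟨ cong₂ _+_ (IsDesign₂-common {M = M} design (punchInᵢ≢i z x ∘ sym))
                   (sym (count-enumerates enum (M (punchIn z x)))) ⟨
    common M z (punchIn z x) + count (λ i → not (M z i) ∧ M (punchIn z x) i)
      ≡⟨ count-split (M z) (M (punchIn z x)) ⟨
    degree M (punchIn z x)      ≡⟨ points (punchIn z x) ⟩
    r                           ≡⟨ lam+ρ≡r ⟨
    lam + ρ                     ∎)

-- Codes over GF(3)

-- GF(3) is finite, so each law is checked by evaluating both sides at every argument.
+₃-assoc : Associative _+₃_
+₃-assoc = toWitness {a? = all? λ a → all? λ c → all? λ d → (a +₃ c) +₃ d ≟ a +₃ (c +₃ d)} _

+₃-comm : Commutative _+₃_
+₃-comm = toWitness {a? = all? λ a → all? λ c → a +₃ c ≟ c +₃ a} _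

+₃-identityˡ : LeftIdentity zero _+₃_
+₃-identityˡ = toWitness {a? = all? λ a → zero +₃ a ≟ a} _

*₃-assoc : Associative _*₃_
*₃-assoc = toWitness {a? = all? λ a → all? λ c → all? λ d → (a *₃ c) *₃ d ≟ a *₃ (c *₃ d)} _

*₃-comm : Commutative _*₃_
*₃-comm = toWitness {a? = all? λ a → all? λ c → a *₃ c ≟ c *₃ a} _

*₃-identityˡ : LeftIdentity (suc zero) _*₃_
*₃-identityˡ = toWitness {a? = all? λ a → suc zero *₃ a ≟ a} _

*₃-distribʳ-+₃ : _*₃_ DistributesOverʳ _+₃_
*₃-distribʳ-+₃ = toWitness {a? = all? λ a → all? λ c → all? λ d → (c +₃ d) *₃ a ≟ (c *₃ a) +₃ (d *₃ a)} _

*₃-zeroˡ : LeftZero zero _*₃_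
*₃-zeroˡ = toWitness {a? = all? λ a → zero *₃ a ≟ zero} _

GF3-commutativeSemiring : CommutativeSemiring 0ℓ 0ℓ
GF3-commutativeSemiring = record
  { Carrier = GF3 ; _≈_ = _≡_ ; _+_ = _+₃_ ; _*_ = _*₃_ ; 0# = zero ; 1# = suc zero
  ; isCommutativeSemiring = isCommutativeSemiringˡ record
    { +-isCommutativeMonoid = isCommutativeMonoidˡ record
      { isSemigroup = record
        { isMagma = record { isEquivalence = isEquivalence ; ∙-cong = cong₂ _+₃_ } ; assoc = +₃-assoc }
      ; identityˡ = +₃-identityˡ
      ; comm = +₃-comm
      }
    ; *-isCommutativeMonoid = isCommutativeMonoidˡ record
      { isSemigroup = record
        { isMagma = record { isEquivalence = isEquivalence ; ∙-cong = cong₂ _*₃_ } ; assoc = *₃-assoc }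
      ; identityˡ = *₃-identityˡ
      ; comm = *₃-comm
      }
    ; distribʳ = *₃-distribʳ-+₃
    ; zeroˡ = *₃-zeroˡ
    }
  }

open CommutativeSemiring GF3-commutativeSemiring using (semiring) renaming (zeroʳ to *₃-zeroʳ)
open SemiringSum semiring using () renaming
  (sum to Σ₃; sum-cong-≗ to Σ₃-cong; ∑-comm to Σ₃-comm; sum-replicate-zero to Σ₃-zero;
   *-distribˡ-sum to *-distribˡ-Σ₃; *-distribʳ-sum to *-distribʳ-Σ₃)

sum₃≡Σ₃ : ∀ {n} (f : Fin n → GF3) → sum₃ f ≡ Σ₃ f
sum₃≡Σ₃ {zero}  f = refl
sum₃≡Σ₃ {suc n} f = cong (f zero +₃_) (sum₃≡Σ₃ (f ∘ suc))

toℕ-mod : ∀ m → toℕ (m mod 3) ≡ m % 3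
toℕ-mod m = toℕ-fromℕ< (m%n<n m 3)

mod-+ : ∀ m n → (m + n) mod 3 ≡ (m mod 3) +₃ (n mod 3)
mod-+ m n = toℕ-injective (begin
  toℕ ((m + n) mod 3)                     ≡⟨ toℕ-mod (m + n) ⟩
  (m + n) % 3                             ≡⟨ %-distribˡ-+ m n 3 ⟩
  (m % 3 + n % 3) % 3                     ≡⟨ cong₂ (λ a c → (a + c) % 3) (toℕ-mod m) (toℕ-mod n) ⟨
  (toℕ (m mod 3) + toℕ (n mod 3)) % 3     ≡⟨ toℕ-mod (toℕ (m mod 3) + toℕ (n mod 3)) ⟨
  toℕ ((m mod 3) +₃ (n mod 3))            ∎)

toGF3≡indicator-mod : ∀ c → toGF3 c ≡ indicator c mod 3
toGF3≡indicator-mod true  = refl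
toGF3≡indicator-mod false = refl

toGF3-∧ : ∀ a c → toGF3 a *₃ toGF3 c ≡ toGF3 (a ∧ c)
toGF3-∧ true  true  = refl
toGF3-∧ true  false = refl
toGF3-∧ false c     = refl

sum₃-toGF3 : ∀ {n} (f : Fin n → Bool) → sum₃ (toGF3 ∘ f) ≡ count f mod 3
sum₃-toGF3 {zero}  f = refl
sum₃-toGF3 {suc n} f = begin
  toGF3 (f zero) +₃ sum₃ (toGF3 ∘ f ∘ suc)
    ≡⟨ cong₂ _+₃_ (toGF3≡indicator-mod (f zero)) (sum₃-toGF3 (f ∘ suc)) ⟩
  (indicator (f zero) mod 3) +₃ (count (f ∘ suc) mod 3)
    ≡⟨ mod-+ (indicator (f zero)) (count (f ∘ suc)) ⟨
  (indicator (f zero) + count (f ∘ suc)) mod 3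
    ∎

dot-columns : ∀ {v b c} (M : Incidence v b) (N : Incidence v c) i j →
  dot (column M i) (column N j) ≡ count (λ p → M p i ∧ N p j) mod 3
dot-columns M N i j = begin
  dot (column M i) (column N j)                 ≡⟨ sum₃≡Σ₃ (λ p → toGF3 (M p i) *₃ toGF3 (N p j)) ⟩
  Σ₃ (λ p → toGF3 (M p i) *₃ toGF3 (N p j))     ≡⟨ Σ₃-cong (λ p → toGF3-∧ (M p i) (N p j)) ⟩
  Σ₃ (λ p → toGF3 (M p i ∧ N p j))              ≡⟨ sum₃≡Σ₃ (λ p → toGF3 (M p i ∧ N p j)) ⟨
  sum₃ (λ p → toGF3 (M p i ∧ N p j))            ≡⟨ sum₃-toGF3 (λ p → M p i ∧ N p j) ⟩
  count (λ p → M p i ∧ N p j) mod 3             ∎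

orthogonal⇒InDualCode : ∀ {v b} (M : Incidence v b) (y : Fin v → GF3) →
  (∀ j → dot (column M j) y ≡ zero) → InDualCode M y
orthogonal⇒InDualCode {v} {b} M y y⊥M x (a , x≡∑) = begin
  dot x y                                             ≡⟨ sum₃≡Σ₃ (λ p → x p *₃ y p) ⟩
  Σ₃ (λ p → x p *₃ y p)                               ≡⟨ Σ₃-cong (λ p → cong (_*₃ y p) (x≡Σ₃ p)) ⟩
  Σ₃ (λ p → Σ₃ (λ j → a j *₃ c j p) *₃ y p)           ≡⟨ Σ₃-cong (λ p → *-distribʳ-Σ₃ (y p) (λ j → a j *₃ c j p)) ⟩
  Σ₃ (λ p → Σ₃ (λ j → (a j *₃ c j p) *₃ y p))         ≡⟨ Σ₃-comm (λ p j → (a j *₃ c j p) *₃ y p) ⟩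
  Σ₃ (λ j → Σ₃ (λ p → (a j *₃ c j p) *₃ y p))         ≡⟨ Σ₃-cong (λ j → Σ₃-cong (λ p → *₃-assoc (a j) (c j p) (y p))) ⟩
  Σ₃ (λ j → Σ₃ (λ p → a j *₃ (c j p *₃ y p)))         ≡⟨ Σ₃-cong (λ j → *-distribˡ-Σ₃ (a j) (λ p → c j p *₃ y p)) ⟨
  Σ₃ (λ j → a j *₃ Σ₃ (λ p → c j p *₃ y p))           ≡⟨ Σ₃-cong (λ j → cong (a j *₃_) (c⊥y j)) ⟩
  Σ₃ (λ j → a j *₃ zero)                              ≡⟨ Σ₃-cong (λ j → *₃-zeroʳ (a j)) ⟩
  Σ₃ {b} (λ _ → zero)                                 ≡⟨ Σ₃-zero b ⟩
  zero                                                ∎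
  where
  c : Fin b → Fin v → GF3
  c = column M
  x≡Σ₃ : ∀ p → x p ≡ Σ₃ (λ j → a j *₃ c j p)
  x≡Σ₃ p = trans (x≡∑ p) (sum₃≡Σ₃ (λ j → a j *₃ c j p))
  c⊥y : ∀ j → Σ₃ (λ p → c j p *₃ y p) ≡ zero
  c⊥y j = trans (sym (sum₃≡Σ₃ (λ p → c j p *₃ y p))) (y⊥M j)

residual-orthogonal : ∀ {v k lam x y b n m} {M : Incidence (suc v) b} →
  IsQuasiSymmetric2 (suc v) k lam x y b M → x mod 3 ≡ zero → y mod 3 ≡ zero →
  ∀ z {e : Fin n → Fin b} {o : Fin m → Fin b} → Enumerates (M z) e → Enumerates (not ∘ M z) o →
  ∀ j → InDualCode (derivedM M z e) (column (residualM M z o) j)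
residual-orthogonal {M = M} (_ , meet) x≡0 y≡0 z {e} {o} (_ , through-z , _) (_ , outside , _) j =
  orthogonal⇒InDualCode (derivedM M z e) (column (residualM M z o) j) orthogonal
  where
  z∉o : M z (o j) ≡ false
  z∉o = not-injective (outside j)
  orthogonal : ∀ i → dot (column (derivedM M z e) i) (column (residualM M z o) j) ≡ zero
  orthogonal i = begin
    dot (column (derivedM M z e) i) (column (residualM M z o) j)
      ≡⟨ dot-columns (derivedM M z e) (residualM M z o) i j ⟩
    count (λ p → M (punchIn z p) (e i) ∧ M (punchIn z p) (o j)) mod 3
      ≡⟨ cong (_mod 3) (count-remove-false (λ p → M p (e i) ∧ M p (o j)) z∉both) ⟨
    common (dual M) (e i) (o j) mod 3
      ≡⟨ [ (λ ≡x → trans (cong (_mod 3) ≡x) x≡0) , (λ ≡y → trans (cong (_mod 3) ≡y) y≡0) ]′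
           (meet (e i) (o j) ei≢oj) ⟩
    zero                                ∎
    where
    z∉both : M z (e i) ∧ M z (o j) ≡ false
    z∉both = cong₂ _∧_ (through-z i) z∉o
    ei≢oj : e i ≢ o j
    ei≢oj ei≡oj = contradiction (trans (sym (through-z i)) (trans (cong (M z) ei≡oj) z∉o)) λ ()

lemma1 : (b : ℕ) (M : Incidence 56 b) → IsQuasiSymmetric2 56 12 9 0 3 b M →
    (z : Fin 56) →
    ((n : ℕ) (e : Fin n → Fin b) → Enumerates (λ j → M z j) e →
      (n ≡ 45) × IsDesign 1 55 11 9 n (derivedM M z e) × IsDesign 2 n 9 2 55 (dual (derivedM M z e))) ×
    ((m : ℕ) (r : Fin m → Fin b) → Enumerates (λ j → not (M z j)) r →
      (m ≡ 165) × IsDesign 1 55 12 36 m (residualM M z r) ×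
      ((n : ℕ) (e : Fin n → Fin b) → Enumerates (λ j → M z j) e →
        (j : Fin m) → InDualCode (derivedM M z e) (column (residualM M z r) j)))
lemma1 b M quasiSymmetric@(design , _) z =
  (λ n e enum → derived-design {M = M} quasiSymmetric replication≡45 z enum) ,
  λ m o enum → let 45+m≡b , residual = residual-design {ρ = 36} {M = M} design replication≡45 refl z enum in
    +-cancelˡ-≡ 45 m 165 (trans 45+m≡b b≡210) , residual ,
    λ n e enum′ → residual-orthogonal {M = M} quasiSymmetric refl refl z enum′ enum
  where
  replication≡45 : ∀ x → degree M x ≡ 45
  replication≡45 x = *-cancelʳ-≡ (degree M x) 45 11 (replication {M = M} design x)
  b≡210 : b ≡ 210
  b≡210 = *-cancelʳ-≡ b 210 12 (incidences {M = M} (proj₁ design) replication≡45)
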